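{- Let $G$ be a graph whose complement contains no copy of $K_{m,m}$, and let $H$ be a $(3,m,n)$-expander in $G$ with $|H|\ge 61m$. Then for any two distinct vertices $x,y\in V(H)$ there is an $x$–$y$ path $P$ in $H$ with $10m\le |P|\le 12m$.
   Context: $m,n$ positive integers; $|P|$ is the number of vertices of $P$. $N_G(S)$ is the set of vertices adjacent to some vertex of $S$. For an induced subgraph $H$ of a graph $G$, $H$ is a $(d,m,n)$-expander in $G$ if (i) $|N_H(S)|\ge d|S|$ for all $S\subseteq V(H)$ with $|S|<m$, and (ii) $|N_G(S)\cup S|\ge n$ for all $S\subseteq V(H)$ with $|S|\ge m$. -}

module Defs where

open import Data.Nat using (ℕ; _≤_; _<_; _*_)
open import Data.Bool using (Bool)
open import Data.Fin using (Fin)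
open import Data.Fin.Subset using (Subset; _∈_; _∉_; _⊆_; ∣_∣; _∪_; _∩_)
open import Data.Fin.Subset.Properties using (_∈?_)
open import Data.Fin.Properties using (any?)
open import Data.Vec using (tabulate)
open import Data.List using (List; length; head; last)
open import Data.List.Relation.Unary.All using (All)
open import Data.List.Relation.Unary.Unique.Propositional using (Unique)
open import Data.List.Relation.Unary.Linked using (Linked)
open import Data.Maybe using (just)
open import Data.Product using (Σ; _×_)
open import Relation.Nullary using (¬_; does)
open import Relation.Nullary.Decidable using (_×-dec_)
open import Relation.Binary using (Decidable; Symmetric)
open import Relation.Binary.PropositionalEquality using (_≡_)

record Graph (N : ℕ) : Set₁ where
  field
    Adj    : Fin N → Fin N → Set
    adj?   : Decidable Adj
    sym    : Symmetric Adj
    irrefl : ∀ v → ¬ Adj v v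
open Graph public

Nbhd : ∀ {N} → Graph N → Subset N → Subset N
Nbhd G S = tabulate λ v → does (any? λ u → (u ∈? S) ×-dec adj? G u v)

-- N_H(S) for the induced subgraph H (given by its vertex set) of G.
NbhdIn : ∀ {N} → Graph N → Subset N → Subset N → Subset N
NbhdIn G H S = Nbhd G S ∩ H

ComplementHasKmm : ∀ {N} → Graph N → ℕ → Set
ComplementHasKmm {N} G m =
  Σ (Subset N) λ A → Σ (Subset N) λ B →
    ∣ A ∣ ≡ m × ∣ B ∣ ≡ m × (∀ v → v ∈ A → v ∉ B) ×
    (∀ a b → a ∈ A → b ∈ B → ¬ Adj G a b)

IsExpander : ∀ {N} → Graph N → Subset N → ℕ → ℕ → ℕ → Set
IsExpander G H d m n =
  (∀ S → S ⊆ H → ∣ S ∣ < m → d * ∣ S ∣ ≤ ∣ NbhdIn G H S ∣) ×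
  (∀ S → S ⊆ H → m ≤ ∣ S ∣ → n ≤ ∣ Nbhd G S ∪ S ∣)

IsPathIn : ∀ {N} → Graph N → Subset N → Fin N → Fin N → List (Fin N) → Set
IsPathIn G H x y P =
  head P ≡ just x × last P ≡ just y × Unique P ×
  Linked (Adj G) P × All (_∈ H) P

module Submission where

-- Grow, inside H, disjoint sets X ∋ x and Y ∋ y of m vertices each, in which every vertex is
-- joined to the root by a path inside the set: as long as |X| = |Y| = t < m, the expansion
-- |N_H(S)| ≥ 3|S| leaves a neighbour of X (then of Y) outside X ∪ Y.  Then run a depth-first
-- search from y in F = H ∖ X, which has at least 13m vertices.  Popped vertices die, and dead
-- vertices have no unvisited neighbours; as the complement of G contains no K_{m,m}, fewer than
-- m vertices can die while the stack has at most 11m vertices, and the stack cannot run empty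
-- because the component of y contains Y.  So the stack becomes a path of 11m vertices ending
-- in y.  Its m topmost vertices and X again span an edge c w with w ∈ X; the path from x to w
-- inside X followed by the stack from c down to y has between 10m and 12m vertices.

open import Defs renaming (sym to Adj-sym)
open import Data.Nat using (ℕ; zero; suc; _≤_; _<_; _*_; _+_; _∸_; NonZero; >-nonZero⁻¹; z≤n; s≤s)
open import Data.Nat.Properties
  using ( ≤-refl; ≤-reflexive; ≤-trans; ≤-antisym; <-irrefl; <⇒≤; <⇒≱; ≤-<-trans; n≤1+n; n<1+n
        ; m≤m+n; m≤n+m; m<m+n; +-comm; +-suc; +-identityʳ; +-mono-≤; +-monoˡ-≤; +-monoʳ-≤
        ; +-monoˡ-<; +-mono-<-≤; +-cancelˡ-≤; +-cancelʳ-≤; *-monoˡ-≤; m≤n⇒m⊓n≡m; m+[n∸m]≡n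
        ; module ≤-Reasoning )
open import Data.Nat.Tactic.RingSolver using (solve-∀)
open import Data.Bool using (true; false)
open import Data.Fin using (Fin; _≟_)
open import Data.Fin.Properties using (any?)
open import Data.Fin.Subset using (Subset; _∈_; _∉_; ∣_∣; _⊆_; _∪_; _─_; _-_; ⁅_⁆; ⊥)
open import Data.Fin.Subset.Properties
  using ( _∈?_; ∉⊥; ⊥⊆; ∣⊥∣≡0; x∈⁅x⁆; x∈⁅y⁆⇒x≡y; ∣⁅x⁆∣≡1; in⊆in; out⊆; p⊆q⇒∣p∣≤∣q∣; p⊂q⇒∣p∣<∣q∣
        ; p⊆p∪q; q⊆p∪q; x∈p∪q⁻; x∈p∩q⁻; p─q⊆p; x∈p∧x∉q⇒x∈p─q; x∈p∧x≢y⇒x∈p-y; x∈p⇒∣p-x∣<∣p∣ )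
open import Data.Vec using ([]; _∷_; here; there)
open import Data.Vec.Properties using ([]=⇒lookup; lookup∘tabulate)
open import Data.List using (List; []; _∷_; length; _++_; last; take)
open import Data.List.Properties using (length-++; length-take)
open import Data.List.Membership.Propositional using () renaming (_∈_ to _∈ₗ_)
open import Data.List.Relation.Unary.All as All using (All; []; _∷_)
import Data.List.Relation.Unary.All.Properties as All
open import Data.List.Relation.Unary.Any as Any using ()
import Data.List.Relation.Unary.AllPairs as AllPairs
open import Data.List.Relation.Unary.AllPairs using ([]; _∷_)
open import Data.List.Relation.Unary.Linked as Linked using (Linked; [-]; _∷_)
import Data.List.Relation.Unary.Linked.Properties as Linked
open import Data.List.Relation.Unary.Unique.Propositional using (Unique)
import Data.List.Relation.Unary.Unique.Propositional.Properties as Unique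
open import Data.List.Relation.Binary.Disjoint.Propositional using (Disjoint)
open import Data.Maybe using (just)
open import Data.Maybe.Properties using (just-injective)
open import Data.Maybe.Relation.Binary.Connected using (Connected; just)
open import Data.Product using (Σ; ∃; ∃₂; _×_; _,_; proj₁; proj₂)
open import Data.Sum as Sum using (_⊎_; inj₁; inj₂; [_,_]′)
open import Data.Empty using (⊥-elim)
open import Function using (_∘_; case_of_)
open import Relation.Nullary using (¬_; yes; no; proof)
open import Relation.Nullary.Decidable using (decidable-stable; _×-dec_; _⊎-dec_; ¬?)
open import Relation.Nullary.Reflects using (Reflects; invert)
open import Relation.Unary using (Pred; Decidable)
open import Relation.Binary.PropositionalEquality using (_≡_; _≢_; refl; sym; trans; cong; subst)

open ≤-Reasoning

n<2*n : ∀ {n} → 1 ≤ n → n < 2 * n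
n<2*n {suc n} _ = m<m+n (suc n) (s≤s z≤n)

1+n<2*n : ∀ {n} → 2 ≤ n → suc n < 2 * n
1+n<2*n {n} 2≤n = subst (suc n <_) (cong (n +_) (sym (+-identityʳ n))) (+-monoˡ-< n 2≤n)

length-bounds : ∀ {m p q s} → p ≤ m → s ≤ m + q → q ≤ s → s ≡ 11 * m → 10 * m ≤ p + q × p + q ≤ 12 * m
length-bounds {m} {p} {q} p≤m s≤m+q q≤s refl =
  ≤-trans (+-cancelˡ-≤ m (10 * m) q s≤m+q) (m≤n+m q p) , +-mono-≤ p≤m q≤s

-- Cardinalities of finite subsets

x∈⁅y⁆∪p⁻ : ∀ {n} {x y : Fin n} {p : Subset n} → x ∈ ⁅ y ⁆ ∪ p → x ≡ y ⊎ x ∈ p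
x∈⁅y⁆∪p⁻ {y = y} {p} x∈ = Sum.map₁ (x∈⁅y⁆⇒x≡y y) (x∈p∪q⁻ ⁅ y ⁆ p x∈)

x∈⁅x⁆∪p : ∀ {n} (x : Fin n) (p : Subset n) → x ∈ ⁅ x ⁆ ∪ p
x∈⁅x⁆∪p x p = p⊆p∪q p (x∈⁅x⁆ x)

x∈p⇒⁅x⁆⊆p : ∀ {n} {x : Fin n} {p : Subset n} → x ∈ p → ⁅ x ⁆ ⊆ p
x∈p⇒⁅x⁆⊆p {x = x} x∈p y∈⁅x⁆ rewrite x∈⁅y⁆⇒x≡y x y∈⁅x⁆ = x∈p

⁅x⁆∪p⊆q : ∀ {n} {x : Fin n} {p q : Subset n} → x ∈ q → p ⊆ q → ⁅ x ⁆ ∪ p ⊆ q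
⁅x⁆∪p⊆q x∈q p⊆q y∈ = [ (λ { refl → x∈q }) , p⊆q ]′ (x∈⁅y⁆∪p⁻ y∈)

x∈p─q⇒x∉q : ∀ {n} {x : Fin n} (p q : Subset n) → x ∈ p ─ q → x ∉ q
x∈p─q⇒x∉q (_ ∷ p) (true ∷ q) ()          here
x∈p─q⇒x∉q (_ ∷ p) (_ ∷ q)    (there x∈) (there x∈q) = x∈p─q⇒x∉q p q x∈ x∈q

∣p∪q∣≤∣p∣+∣q∣ : ∀ {n} (p q : Subset n) → ∣ p ∪ q ∣ ≤ ∣ p ∣ + ∣ q ∣
∣p∪q∣≤∣p∣+∣q∣ []          []          = z≤n
∣p∪q∣≤∣p∣+∣q∣ (true ∷ p)  (true ∷ q)  = s≤s (≤-trans (∣p∪q∣≤∣p∣+∣q∣ p q) (+-monoʳ-≤ ∣ p ∣ (n≤1+n ∣ q ∣)))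
∣p∪q∣≤∣p∣+∣q∣ (true ∷ p)  (false ∷ q) = s≤s (∣p∪q∣≤∣p∣+∣q∣ p q)
∣p∪q∣≤∣p∣+∣q∣ (false ∷ p) (true ∷ q)  = ≤-trans (s≤s (∣p∪q∣≤∣p∣+∣q∣ p q)) (≤-reflexive (sym (+-suc ∣ p ∣ ∣ q ∣)))
∣p∪q∣≤∣p∣+∣q∣ (false ∷ p) (false ∷ q) = ∣p∪q∣≤∣p∣+∣q∣ p q

x∉p⇒∣⁅x⁆∪p∣≡1+∣p∣ : ∀ {n} {x : Fin n} {p : Subset n} → x ∉ p → ∣ ⁅ x ⁆ ∪ p ∣ ≡ suc ∣ p ∣
x∉p⇒∣⁅x⁆∪p∣≡1+∣p∣ {x = x} {p} x∉p = ≤-antisym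
  (≤-trans (∣p∪q∣≤∣p∣+∣q∣ ⁅ x ⁆ p) (≤-reflexive (cong (_+ ∣ p ∣) (∣⁅x⁆∣≡1 x))))
  (p⊂q⇒∣p∣<∣q∣ (q⊆p∪q ⁅ x ⁆ p , x , x∈⁅x⁆∪p x p , x∉p))

∣p∣≤∣p─q∣+∣q∣ : ∀ {n} (p q : Subset n) → ∣ p ∣ ≤ ∣ p ─ q ∣ + ∣ q ∣
∣p∣≤∣p─q∣+∣q∣ p q = ≤-trans (p⊆q⇒∣p∣≤∣q∣ p⊆p─q∪q) (∣p∪q∣≤∣p∣+∣q∣ (p ─ q) q)
  where
  p⊆p─q∪q : p ⊆ (p ─ q) ∪ q
  p⊆p─q∪q {x} x∈p with x ∈? q
  ... | yes x∈q = q⊆p∪q (p ─ q) q x∈q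
  ... | no  x∉q = p⊆p∪q q (x∈p∧x∉q⇒x∈p─q x∈p x∉q)

∣p∣≡1⇒x≡y : ∀ {n} {x y : Fin n} {p : Subset n} → ∣ p ∣ ≡ 1 → x ∈ p → y ∈ p → x ≡ y
∣p∣≡1⇒x≡y {x = x} {y} {p} ∣p∣≡1 x∈p y∈p = decidable-stable (x ≟ y) λ x≢y →
  <-irrefl refl (begin-strict
    1         ≡⟨ sym (∣⁅x⁆∣≡1 x) ⟩
    ∣ ⁅ x ⁆ ∣ ≤⟨ p⊆q⇒∣p∣≤∣q∣ (x∈p⇒⁅x⁆⊆p (x∈p∧x≢y⇒x∈p-y x∈p x≢y)) ⟩
    ∣ p - y ∣ <⟨ x∈p⇒∣p-x∣<∣p∣ y∈p ⟩
    ∣ p ∣     ≡⟨ ∣p∣≡1 ⟩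
    1         ∎)

⊆-of-size : ∀ {n} m (p : Subset n) → m ≤ ∣ p ∣ → Σ (Subset n) λ q → q ⊆ p × ∣ q ∣ ≡ m
⊆-of-size {n} zero    p           _         = ⊥ , ⊥⊆ , ∣⊥∣≡0 n
⊆-of-size     (suc m) (true ∷ p)  (s≤s m≤p) with ⊆-of-size m p m≤p
... | q , q⊆p , ∣q∣≡m = true ∷ q , in⊆in q⊆p , cong suc ∣q∣≡m
⊆-of-size     (suc m) (false ∷ p) m<p       with ⊆-of-size (suc m) p m<p
... | q , q⊆p , ∣q∣≡m = false ∷ q , out⊆ q⊆p , ∣q∣≡m

counterexample⊎⊆ : ∀ {n p q} {P : Pred (Fin n) p} {Q : Pred (Fin n) q} → Decidable P → Decidable Q →
                   (∃ λ x → P x × ¬ Q x) ⊎ (∀ {x} → P x → Q x)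
counterexample⊎⊆ P? Q? with any? (λ x → P? x ×-dec ¬? (Q? x))
... | yes counterexample = inj₁ counterexample
... | no  none           = inj₂ λ {x} Px → decidable-stable (Q? x) λ ¬Qx → none (x , Px , ¬Qx)

unique⇒length≤∣p∣ : ∀ {n} {xs : List (Fin n)} {p : Subset n} → Unique xs → All (_∈ p) xs → length xs ≤ ∣ p ∣
unique⇒length≤∣p∣ {xs = []}     _              _            = z≤n
unique⇒length≤∣p∣ {xs = x ∷ xs} {p} (x∉xs ∷ uniq) (x∈p ∷ xs⊆p) = begin-strict
  length xs ≤⟨ unique⇒length≤∣p∣ uniq (All.zipWith (λ (y∈p , x≢y) → x∈p∧x≢y⇒x∈p-y y∈p (x≢y ∘ sym)) (xs⊆p , x∉xs)) ⟩
  ∣ p - x ∣ <⟨ x∈p⇒∣p-x∣<∣p∣ x∈p ⟩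
  ∣ p ∣     ∎

fromList : ∀ {n} → List (Fin n) → Subset n
fromList []       = ⊥
fromList (x ∷ xs) = ⁅ x ⁆ ∪ fromList xs

∈fromList⁺ : ∀ {n} {x : Fin n} {xs} → x ∈ₗ xs → x ∈ fromList xs
∈fromList⁺ {xs = y ∷ xs} (Any.here refl) = x∈⁅x⁆∪p y (fromList xs)
∈fromList⁺ {xs = y ∷ xs} (Any.there x∈)  = q⊆p∪q ⁅ y ⁆ (fromList xs) (∈fromList⁺ x∈)

∈fromList⁻ : ∀ {n} {x : Fin n} xs → x ∈ fromList xs → x ∈ₗ xs
∈fromList⁻ []       x∈ = ⊥-elim (∉⊥ x∈)
∈fromList⁻ (y ∷ xs) x∈ = [ Any.here , Any.there ∘ ∈fromList⁻ xs ]′ (x∈⁅y⁆∪p⁻ x∈)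

∣fromList∣≤length : ∀ {n} (xs : List (Fin n)) → ∣ fromList xs ∣ ≤ length xs
∣fromList∣≤length {n} []       = ≤-reflexive (∣⊥∣≡0 n)
∣fromList∣≤length     (x ∷ xs) = begin
  ∣ ⁅ x ⁆ ∪ fromList xs ∣         ≤⟨ ∣p∪q∣≤∣p∣+∣q∣ ⁅ x ⁆ (fromList xs) ⟩
  ∣ ⁅ x ⁆ ∣ + ∣ fromList xs ∣     ≡⟨ cong (_+ ∣ fromList xs ∣) (∣⁅x⁆∣≡1 x) ⟩
  suc ∣ fromList xs ∣             ≤⟨ s≤s (∣fromList∣≤length xs) ⟩
  suc (length xs)                 ∎

length≤∣fromList∣ : ∀ {n} {xs : List (Fin n)} → Unique xs → length xs ≤ ∣ fromList xs ∣
length≤∣fromList∣ uniq = unique⇒length≤∣p∣ uniq (All.tabulate ∈fromList⁺)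

∈take⇒split : ∀ {a} {A : Set a} m (xs : List A) {x} → x ∈ₗ take m xs →
              ∃₂ λ ys zs → xs ≡ ys ++ x ∷ zs × length ys < m
∈take⇒split (suc m) (y ∷ xs) (Any.here refl) = [] , xs , refl , s≤s z≤n
∈take⇒split (suc m) (y ∷ xs) (Any.there x∈) =
  let ys , zs , xs≡ , ys<m = ∈take⇒split m xs x∈ in y ∷ ys , zs , cong (y ∷_) xs≡ , s≤s ys<m

last-++ : ∀ {a} {A : Set a} (xs : List A) {y ys} → last (xs ++ y ∷ ys) ≡ last (y ∷ ys)
last-++ []            = refl
last-++ (x ∷ [])      = refl
last-++ (x ∷ x′ ∷ xs) = last-++ (x′ ∷ xs)

last⇒∈ : ∀ {a} {A : Set a} (xs : List A) {y} → last xs ≡ just y → y ∈ₗ xs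
last⇒∈ (x ∷ [])      refl = Any.here refl
last⇒∈ (x ∷ x′ ∷ xs) eq   = Any.there (last⇒∈ (x′ ∷ xs) eq)

module _ {N : ℕ} (G : Graph N) where

  ∈Nbhd⁻ : ∀ {S u} → u ∈ Nbhd G S → ∃ λ s → s ∈ S × Adj G s u
  ∈Nbhd⁻ {S} {u} u∈N = invert (subst (Reflects _) chosen (proof (any? λ s → (s ∈? S) ×-dec adj? G s u)))
    where chosen = trans (sym (lookup∘tabulate _ u)) ([]=⇒lookup u∈N)

  edge-between : ∀ {m A B} → ¬ ComplementHasKmm G m → (∀ {v} → v ∈ A → v ∉ B) →
                 m ≤ ∣ A ∣ → m ≤ ∣ B ∣ → ∃₂ λ a b → a ∈ A × b ∈ B × Adj G a b
  edge-between {m} {A} {B} Kmm-free A∩B≡∅ m≤∣A∣ m≤∣B∣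
    with ⊆-of-size m A m≤∣A∣ | ⊆-of-size m B m≤∣B∣
  ... | A′ , A′⊆A , ∣A′∣≡m | B′ , B′⊆B , ∣B′∣≡m
    with any? (λ a → (a ∈? A′) ×-dec any? (λ b → (b ∈? B′) ×-dec adj? G a b))
  ... | yes (a , a∈A′ , b , b∈B′ , ab) = a , b , A′⊆A a∈A′ , B′⊆B b∈B′ , ab
  ... | no  no-edge = ⊥-elim (Kmm-free (A′ , B′ , ∣A′∣≡m , ∣B′∣≡m ,
          (λ v v∈A′ v∈B′ → A∩B≡∅ (A′⊆A v∈A′) (B′⊆B v∈B′)) ,
          λ a b a∈A′ b∈B′ ab → no-edge (a , a∈A′ , b , b∈B′ , ab)))

  -- Paths

  path-[_] : ∀ {S v} → v ∈ S → IsPathIn G S v v (v ∷ [])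
  path-[ v∈S ] = refl , refl , [] ∷ [] , [-] , v∈S ∷ []

  path-⊆ : ∀ {S a b P v} → IsPathIn G S a b P → v ∈ₗ P → v ∈ S
  path-⊆ (_ , _ , _ , _ , P⊆S) = All.lookup P⊆S

  path-mono : ∀ {S T a b P} → S ⊆ T → IsPathIn G S a b P → IsPathIn G T a b P
  path-mono S⊆T (hd , lst , uniq , linked , P⊆S) = hd , lst , uniq , linked , All.map S⊆T P⊆S

  path-length≤ : ∀ {S a b P} → IsPathIn G S a b P → length P ≤ ∣ S ∣
  path-length≤ (_ , _ , uniq , _ , P⊆S) = unique⇒length≤∣p∣ uniq P⊆S

  path-tail : ∀ {S a b x c P} → IsPathIn G S a b (x ∷ c ∷ P) → IsPathIn G S c b (c ∷ P)
  path-tail (_ , lst , uniq , linked , P⊆S) = refl , lst , AllPairs.tail uniq , Linked.tail linked , All.tail P⊆S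

  path-suffix : ∀ xs {S a b c P} → IsPathIn G S a b (xs ++ c ∷ P) → IsPathIn G S c b (c ∷ P)
  path-suffix []            (_ , path) = refl , path
  path-suffix (x ∷ [])      path       = path-tail path
  path-suffix (x ∷ x′ ∷ xs) path       = path-suffix (x′ ∷ xs) (path-tail path)

  path-++ : ∀ {S a b c d P Q} → IsPathIn G S a b P → IsPathIn G S c d Q → Adj G b c → Disjoint P Q →
            IsPathIn G S a d (P ++ Q)
  path-++ {c = c} {P = P@(_ ∷ _)} {Q = _ ∷ _}
          (refl , lastP , uniqP , linkedP , P⊆S) (refl , lastQ , uniqQ , linkedQ , Q⊆S) bc P∩Q≡∅ =
    refl , trans (last-++ P) lastQ , Unique.++⁺ uniqP uniqQ P∩Q≡∅ ,
    Linked.++⁺ linkedP (subst (λ z → Connected (Adj G) z (just c)) (sym lastP) (just bc)) linkedQ ,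
    All.++⁺ P⊆S Q⊆S

  Rooted : Subset N → Fin N → Set
  Rooted S r = ∀ {w} → w ∈ S → ∃ λ P → IsPathIn G S r w P

  rooted-⁅⁆ : ∀ r → Rooted ⁅ r ⁆ r
  rooted-⁅⁆ r w∈⁅r⁆ rewrite x∈⁅y⁆⇒x≡y r w∈⁅r⁆ = _ , path-[ x∈⁅x⁆ r ]

  rooted-∪ : ∀ {S r s u} → Rooted S r → s ∈ S → Adj G s u → u ∉ S → Rooted (⁅ u ⁆ ∪ S) r
  rooted-∪ {S} {u = u} rooted s∈S su u∉S w∈ with x∈⁅y⁆∪p⁻ w∈
  ... | inj₁ refl =
    let P , path = rooted s∈S in
    P ++ u ∷ [] , path-++ (path-mono (q⊆p∪q ⁅ u ⁆ S) path) path-[ x∈⁅x⁆∪p u S ] su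
                    λ { (u∈P , Any.here refl) → u∉S (path-⊆ path u∈P) }
  ... | inj₂ w∈S = let P , path = rooted w∈S in P , path-mono (q⊆p∪q ⁅ u ⁆ S) path

  Closed : Subset N → Subset N → List (Fin N) → Set
  Closed F D st = ∀ {d u} → d ∈ D → Adj G d u → u ∈ F → u ∈ D ⊎ u ∈ₗ st

  closed-along : ∀ {F D a P} → Closed F D [] → Linked (Adj G) (a ∷ P) → All (_∈ F) P → a ∈ D → All (_∈ D) (a ∷ P)
  closed-along {P = []}    _      _             _           a∈D = a∈D ∷ []
  closed-along {P = c ∷ P} closed (ac ∷ linked) (c∈F ∷ P⊆F) a∈D with closed a∈D ac c∈F
  ... | inj₁ c∈D = a∈D ∷ closed-along closed linked P⊆F c∈D

  rooted⊆closed : ∀ {F D S r} → Rooted S r → S ⊆ F → r ∈ D → Closed F D [] → S ⊆ D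
  rooted⊆closed rooted S⊆F r∈D closed w∈S with rooted w∈S
  ... | P@(_ ∷ _) , refl , lastP , _ , linked , P⊆S =
    All.lookup (closed-along closed linked (All.map S⊆F (All.tail P⊆S)) r∈D) (last⇒∈ P lastP)

  -- Depth-first search

  module _ {m} (Kmm-free : ¬ ComplementHasKmm G m) {F : Subset N} {k : ℕ} (room : k + (m + m) ≤ ∣ F ∣)
           {r : Fin N} (r∈F : r ∈ F) (component-large : ∀ {D} → r ∈ D → Closed F D [] → m ≤ ∣ D ∣) where

    m≤∣unvisited∣ : ∀ {D st} → ∣ D ∣ ≤ m → length st ≤ k → m ≤ ∣ F ─ (D ∪ fromList st) ∣
    m≤∣unvisited∣ {D} {st} ∣D∣≤m st≤k = +-cancelˡ-≤ (m + k) m ∣ U ∣ (begin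
      m + k + m         ≡⟨ reorder m k ⟩
      k + (m + m)       ≤⟨ room ⟩
      ∣ F ∣             ≤⟨ ∣p∣≤∣p─q∣+∣q∣ F (D ∪ S) ⟩
      ∣ U ∣ + ∣ D ∪ S ∣ ≤⟨ +-monoʳ-≤ ∣ U ∣ (≤-trans (∣p∪q∣≤∣p∣+∣q∣ D S)
                              (+-mono-≤ ∣D∣≤m (≤-trans (∣fromList∣≤length st) st≤k))) ⟩
      ∣ U ∣ + (m + k)   ≡⟨ +-comm ∣ U ∣ (m + k) ⟩
      m + k + ∣ U ∣     ∎)
      where
      S = fromList st
      U = F ─ (D ∪ S)
      reorder : ∀ m k → m + k + m ≡ k + (m + m)
      reorder = solve-∀

    -- The m vertices of D and the at least m unvisited ones would span a K_{m,m} in the complement.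
    barrier : ∀ {D st} → Closed F D st → length st ≤ k → ∣ D ∣ ≢ m
    barrier {D} {st} closed st≤k ∣D∣≡m
      with edge-between Kmm-free (λ v∈D v∈U → x∈p─q⇒x∉q F _ v∈U (p⊆p∪q (fromList st) v∈D))
             (≤-reflexive (sym ∣D∣≡m)) (m≤∣unvisited∣ {D} {st} (≤-reflexive ∣D∣≡m) st≤k)
    ... | d , u , d∈D , u∈U , du =
      [ (λ u∈D → u∉D∪S (p⊆p∪q (fromList st) u∈D)) , (λ u∈st → u∉D∪S (q⊆p∪q D _ (∈fromList⁺ u∈st))) ]′
        (closed d∈D du (p─q⊆p F _ u∈U))
      where u∉D∪S = x∈p─q⇒x∉q F (D ∪ fromList st) u∈U

    -- Pushing lowers i and popping lowers j, so dfs terminates by lexicographic recursion on (j , i).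
    record Search (j i : ℕ) (top : Fin N) (below : List (Fin N)) : Set where
      field
        dead   : Subset N
        path   : IsPathIn G F top r (top ∷ below)
        alive  : All (_∉ dead) (top ∷ below)
        closed : Closed F dead (top ∷ below)
        ∣dead∣ : ∣ dead ∣ + j ≡ m
        height : length (top ∷ below) + i ≡ k

    Visited : ∀ {j i top below} → Search j i top below → Set
    Visited {top = top} {below} σ = ∀ {u} → Adj G top u × u ∈ F → u ∈ Search.dead σ ⊎ u ∈ₗ top ∷ below

    push : ∀ {j i top below u} (σ : Search j (suc i) top below) → Adj G top u → u ∈ F →
           ¬ (u ∈ Search.dead σ ⊎ u ∈ₗ top ∷ below) → Search j i u (top ∷ below)
    push {i = i} σ tu u∈F unvisited = record
      { dead   = dead
      ; path   = path-++ path-[ u∈F ] path (Adj-sym G tu) λ { (Any.here refl , u∈st) → unvisited (inj₂ u∈st) }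
      ; alive  = (λ u∈D → unvisited (inj₁ u∈D)) ∷ alive
      ; closed = λ d∈D du v∈F → Sum.map₂ Any.there (closed d∈D du v∈F)
      ; ∣dead∣ = ∣dead∣
      ; height = trans (sym (+-suc _ i)) height
      }
      where open Search σ

    module _ {j i top below} (σ : Search (suc j) i top below) (visited : Visited σ) where
      open Search σ

      retreat-closed : Closed F (⁅ top ⁆ ∪ dead) below
      retreat-closed d∈ du u∈F =
        shift ([ (λ { refl → visited (du , u∈F) }) , (λ d∈D → closed d∈D du u∈F) ]′ (x∈⁅y⁆∪p⁻ d∈))
        where
        shift : ∀ {u} → u ∈ dead ⊎ u ∈ₗ top ∷ below → u ∈ ⁅ top ⁆ ∪ dead ⊎ u ∈ₗ below
        shift (inj₁ u∈D)             = inj₁ (q⊆p∪q ⁅ top ⁆ dead u∈D)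
        shift (inj₂ (Any.here refl)) = inj₁ (x∈⁅x⁆∪p top dead)
        shift (inj₂ (Any.there u∈))  = inj₂ u∈

      retreat-size : ∣ ⁅ top ⁆ ∪ dead ∣ + j ≡ m
      retreat-size = trans (cong (_+ j) (x∉p⇒∣⁅x⁆∪p∣≡1+∣p∣ (All.head alive))) (trans (sym (+-suc ∣ dead ∣ j)) ∣dead∣)

    pop : ∀ {j i top below} (σ : Search (suc j) i top below) → Visited σ →
          ∃₂ λ top′ below′ → Search j (suc i) top′ below′
    pop {j} {top = top} {[]} σ visited =
      ⊥-elim (barrier (retreat-closed σ visited) z≤n (≤-antisym
        (≤-trans (m≤m+n _ j) (≤-reflexive (retreat-size σ visited)))
        (component-large r∈⁅top⁆∪dead (retreat-closed σ visited))))
      where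
      open Search σ
      r∈⁅top⁆∪dead = subst (_∈ ⁅ top ⁆ ∪ dead) (just-injective (proj₁ (proj₂ path))) (x∈⁅x⁆∪p top dead)
    pop {i = i} {top = top} {b ∷ below} σ visited = b , below , record
      { dead   = ⁅ top ⁆ ∪ dead
      ; path   = path-tail path
      ; alive  = All.zipWith (λ (v∉D , top≢v) v∈ → [ (λ { refl → top≢v refl }) , v∉D ]′ (x∈⁅y⁆∪p⁻ v∈))
                             (All.tail alive , AllPairs.head (proj₁ (proj₂ (proj₂ path))))
      ; closed = retreat-closed σ visited
      ; ∣dead∣ = retreat-size σ visited
      ; height = trans (+-suc _ i) height
      }
      where open Search σ

    dfs : ∀ j i {top below} → Search j i top below → ∃₂ λ top′ st → IsPathIn G F top′ r st × length st ≡ k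
    dfs j zero σ = _ , _ , path , trans (sym (+-identityʳ _)) height
      where open Search σ
    dfs zero (suc i) σ =
      ⊥-elim (barrier closed (≤-trans (m≤m+n _ _) (≤-reflexive height)) (trans (sym (+-identityʳ _)) ∣dead∣))
      where open Search σ
    dfs (suc j) (suc i) {top} {below} σ =
      [ (λ (u , (tu , u∈F) , unvisited) → dfs (suc j) i (push σ tu u∈F unvisited))
      , (λ (visited : Visited σ) → let _ , _ , σ′ = pop σ visited in dfs j (suc (suc i)) σ′)
      ]′ (counterexample⊎⊆ (λ u → adj? G top u ×-dec u ∈? F)
                          (λ u → u ∈? Search.dead σ ⊎-dec Any.any? (u ≟_) (top ∷ below)))

    long-path : 1 ≤ k → ∃₂ λ top st → IsPathIn G F top r st × length st ≡ k
    long-path 1≤k = dfs m (k ∸ 1) {r} {[]} record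
      { dead   = ⊥
      ; path   = path-[ r∈F ]
      ; alive  = ∉⊥ ∷ []
      ; closed = λ d∈⊥ → ⊥-elim (∉⊥ d∈⊥)
      ; ∣dead∣ = cong (_+ m) (∣⊥∣≡0 N)
      ; height = m+[n∸m]≡n 1≤k
      }

  suffix-adjacent-to : ∀ {m F X a b st} → ¬ ComplementHasKmm G m → (∀ {v} → v ∈ F → v ∉ X) → m ≤ ∣ X ∣ →
                       m ≤ length st → IsPathIn G F a b st →
                       ∃₂ λ w c → ∃ λ Q → w ∈ X × Adj G w c × IsPathIn G F c b Q ×
                                          length st ≤ m + length Q × length Q ≤ length st
  suffix-adjacent-to {m} {F} {X} {st = st} Kmm-free F∩X≡∅ m≤∣X∣ m≤∣st∣ path@(_ , _ , uniq , _ , st⊆F)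
    with edge-between Kmm-free (λ v∈top → F∩X≡∅ (All.lookup (All.take⁺ m st⊆F) (∈fromList⁻ (take m st) v∈top)))
           (≤-trans (≤-reflexive (sym (trans (length-take m st) (m≤n⇒m⊓n≡m m≤∣st∣))))
                    (length≤∣fromList∣ (Unique.take⁺ m uniq)))
           m≤∣X∣
  ... | c , w , c∈top , w∈X , cw with ∈take⇒split m st (∈fromList⁻ (take m st) c∈top)
  ... | ys , zs , refl , ys<m =
    w , c , c ∷ zs , w∈X , Adj-sym G cw , path-suffix ys path ,
    ≤-trans (≤-reflexive (length-++ ys)) (+-monoˡ-≤ (length (c ∷ zs)) (<⇒≤ ys<m)) ,
    ≤-trans (m≤n+m _ (length ys)) (≤-reflexive (sym (length-++ ys)))

  -- Growing the two seeds

  module _ (H : Subset N) where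

    record RootedSet (r : Fin N) (t : ℕ) : Set where
      constructor rootedSet
      field
        vertices : Subset N
        size     : ∣ vertices ∣ ≡ t
        ⊆H       : vertices ⊆ H
        rooted   : Rooted vertices r
    open RootedSet

    singleton : ∀ {r} → r ∈ H → RootedSet r 1
    singleton {r} r∈H = rootedSet ⁅ r ⁆ (∣⁅x⁆∣≡1 r) (x∈p⇒⁅x⁆⊆p r∈H) (rooted-⁅⁆ r)

    extend : ∀ {r t s u} (R : RootedSet r t) → s ∈ vertices R → u ∈ H → Adj G s u → u ∉ vertices R →
             RootedSet r (suc t)
    extend (rootedSet S ∣S∣≡t S⊆H rooted) s∈S u∈H su u∉S = rootedSet (⁅ _ ⁆ ∪ S)
      (trans (x∉p⇒∣⁅x⁆∪p∣≡1+∣p∣ u∉S) (cong suc ∣S∣≡t)) (⁅x⁆∪p⊆q u∈H S⊆H) (rooted-∪ rooted s∈S su u∉S)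

    record Seeds (x y : Fin N) (a b : ℕ) : Set where
      constructor seeds
      field
        X     : RootedSet x a
        Y     : RootedSet y b
        y∈Y   : y ∈ vertices Y
        X∩Y≡∅ : ∀ {v} → v ∈ vertices X → v ∉ vertices Y

    initial-seeds : ∀ {x y} → x ∈ H → y ∈ H → x ≢ y → Seeds x y 1 1
    initial-seeds {x} {y} x∈H y∈H x≢y = seeds (singleton x∈H) (singleton y∈H) (x∈⁅x⁆ y)
      λ v∈⁅x⁆ v∈⁅y⁆ → x≢y (trans (sym (x∈⁅y⁆⇒x≡y x v∈⁅x⁆)) (x∈⁅y⁆⇒x≡y y v∈⁅y⁆))

    module _ (m : ℕ) (expands : ∀ S → S ⊆ H → ∣ S ∣ < m → 3 * ∣ S ∣ ≤ ∣ NbhdIn G H S ∣) where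

      fresh-neighbour : ∀ {S B t} → S ⊆ H → ∣ S ∣ ≡ t → t < m → ∣ B ∣ < 3 * t →
                        ∃₂ λ s u → s ∈ S × u ∈ H × Adj G s u × u ∉ B
      fresh-neighbour {S} {B} S⊆H refl ∣S∣<m ∣B∣<3∣S∣ with counterexample⊎⊆ (_∈? NbhdIn G H S) (_∈? B)
      ... | inj₂ N⊆B = ⊥-elim (<⇒≱ ∣B∣<3∣S∣ (≤-trans (expands S S⊆H ∣S∣<m) (p⊆q⇒∣p∣≤∣q∣ N⊆B)))
      ... | inj₁ (u , u∈N , u∉B) with x∈p∩q⁻ (Nbhd G S) H u∈N
      ... | u∈NS , u∈H = let s , s∈S , su = ∈Nbhd⁻ u∈NS in s , u , s∈S , u∈H , su , u∉B

      fresh-neighbour-outside : ∀ {S B t} → S ⊆ H → ∣ S ∣ ≡ t → t < m → ∣ B ∣ < 2 * t →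
                                ∃₂ λ s u → s ∈ S × u ∈ H × Adj G s u × u ∉ B × u ∉ S
      fresh-neighbour-outside {S} {B} {t} S⊆H ∣S∣≡t t<m ∣B∣<2t
        with fresh-neighbour {B = B ∪ S} S⊆H ∣S∣≡t t<m (begin-strict
               ∣ B ∪ S ∣     ≤⟨ ∣p∪q∣≤∣p∣+∣q∣ B S ⟩
               ∣ B ∣ + ∣ S ∣ <⟨ +-mono-<-≤ ∣B∣<2t (≤-reflexive ∣S∣≡t) ⟩
               2 * t + t     ≡⟨ +-comm (2 * t) t ⟩
               3 * t         ∎)
      ... | s , u , s∈S , u∈H , su , u∉B∪S =
        s , u , s∈S , u∈H , su , (λ u∈B → u∉B∪S (p⊆p∪q S u∈B)) , (λ u∈S → u∉B∪S (q⊆p∪q B S u∈S))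

      grow-X : ∀ {x y t} → 1 ≤ t → t < m → Seeds x y t t → Seeds x y (suc t) t
      grow-X {t = t} 1≤t t<m (seeds X Y y∈Y X∩Y≡∅)
        with fresh-neighbour-outside (⊆H X) (size X) t<m (subst (_< 2 * t) (sym (size Y)) (n<2*n 1≤t))
      ... | s , u , s∈X , u∈H , su , u∉Y , u∉X = seeds (extend X s∈X u∈H su u∉X) Y y∈Y
        λ v∈X′ v∈Y → [ (λ { refl → u∉Y v∈Y }) , (λ v∈X → X∩Y≡∅ v∈X v∈Y) ]′ (x∈⁅y⁆∪p⁻ v∈X′)

      -- For t = 1 the bound |X ∪ Y| = 3 is too weak, but no neighbour of the single vertex y is in Y.
      fresh-neighbour-of-Y : ∀ {x y t} → 1 ≤ t → t < m → (σ : Seeds x y (suc t) t) →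
                             let open Seeds σ in
                             ∃₂ λ s u → s ∈ vertices Y × u ∈ H × Adj G s u × u ∉ vertices X × u ∉ vertices Y
      fresh-neighbour-of-Y {t = 1} _ t<m (seeds X Y _ _)
        with fresh-neighbour (⊆H Y) (size Y) t<m (subst (_< 3) (sym (size X)) (n<1+n 2))
      ... | s , u , s∈Y , u∈H , su , u∉X =
        s , u , s∈Y , u∈H , su , u∉X , λ u∈Y → irrefl G s (subst (Adj G s) (∣p∣≡1⇒x≡y (size Y) u∈Y s∈Y) su)
      fresh-neighbour-of-Y {t = suc (suc t)} _ t<m (seeds X Y _ _) =
        fresh-neighbour-outside (⊆H Y) (size Y) t<m
          (subst (_< 2 * suc (suc t)) (sym (size X)) (1+n<2*n (s≤s (s≤s z≤n))))

      grow-Y : ∀ {x y t} → 1 ≤ t → t < m → Seeds x y (suc t) t → Seeds x y (suc t) (suc t)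
      grow-Y 1≤t t<m σ@(seeds X Y y∈Y X∩Y≡∅) with fresh-neighbour-of-Y 1≤t t<m σ
      ... | s , u , s∈Y , u∈H , su , u∉X , u∉Y = seeds X (extend Y s∈Y u∈H su u∉Y) (q⊆p∪q ⁅ u ⁆ _ y∈Y)
        λ v∈X v∈Y′ → [ (λ { refl → u∉X v∈X }) , X∩Y≡∅ v∈X ]′ (x∈⁅y⁆∪p⁻ v∈Y′)

      seeds-of-size : ∀ {x y} → x ∈ H → y ∈ H → x ≢ y → ∀ t → 1 ≤ t → t ≤ m → Seeds x y t t
      seeds-of-size x∈H y∈H x≢y (suc zero)    _ _   = initial-seeds x∈H y∈H x≢y
      seeds-of-size x∈H y∈H x≢y (suc (suc t)) _ t<m =
        grow-Y (s≤s z≤n) t<m (grow-X (s≤s z≤n) t<m (seeds-of-size x∈H y∈H x≢y (suc t) (s≤s z≤n) (<⇒≤ t<m)))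

    outside : ∀ {x y a b} → Seeds x y a b → Subset N
    outside σ = H ─ vertices (Seeds.X σ)

    outside∩X≡∅ : ∀ {x y a b} (σ : Seeds x y a b) {v} → v ∈ outside σ → v ∉ vertices (Seeds.X σ)
    outside∩X≡∅ σ = x∈p─q⇒x∉q H (vertices (Seeds.X σ))

    Y⊆outside : ∀ {x y a b} (σ : Seeds x y a b) → vertices (Seeds.Y σ) ⊆ outside σ
    Y⊆outside (seeds X Y _ X∩Y≡∅) v∈Y = x∈p∧x∉q⇒x∈p─q (⊆H Y v∈Y) (λ v∈X → X∩Y≡∅ v∈X v∈Y)

    closed∋y⇒large : ∀ {x y a b} (σ : Seeds x y a b) {D} → y ∈ D → Closed (outside σ) D [] → b ≤ ∣ D ∣
    closed∋y⇒large σ@(seeds _ Y _ _) y∈D closed =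
      ≤-trans (≤-reflexive (sym (size Y))) (p⊆q⇒∣p∣≤∣q∣ (rooted⊆closed (rooted Y) (Y⊆outside σ) y∈D closed))

    room-outside : ∀ {m x y} (σ : Seeds x y m m) → 14 * m ≤ ∣ H ∣ → 11 * m + (m + m) ≤ ∣ outside σ ∣
    room-outside {m} σ@(seeds X _ _ _) 14m≤∣H∣ = +-cancelʳ-≤ m _ _ (begin
      11 * m + (m + m) + m               ≡⟨ fourteen m ⟩
      14 * m                             ≤⟨ 14m≤∣H∣ ⟩
      ∣ H ∣                              ≤⟨ ∣p∣≤∣p─q∣+∣q∣ H (vertices X) ⟩
      ∣ outside σ ∣ + ∣ vertices X ∣     ≡⟨ cong (∣ outside σ ∣ +_) (size X) ⟩
      ∣ outside σ ∣ + m                  ∎)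
      where
      fourteen : ∀ m → 11 * m + (m + m) + m ≡ 14 * m
      fourteen = solve-∀

    path-between : ∀ {m x y} → 1 ≤ m → ¬ ComplementHasKmm G m → 14 * m ≤ ∣ H ∣ → Seeds x y m m →
                   ∃ λ P → IsPathIn G H x y P × 10 * m ≤ length P × length P ≤ 12 * m
    path-between {m} 1≤m Kmm-free 14m≤∣H∣ σ@(seeds X Y y∈Y _) =
      case long-path Kmm-free (room-outside σ 14m≤∣H∣) (Y⊆outside σ y∈Y) (closed∋y⇒large σ)
                     (≤-trans 1≤m (m≤m+n m (10 * m))) of λ
      { (_ , st , st-path , ∣st∣≡11m) →
      case suffix-adjacent-to Kmm-free (outside∩X≡∅ σ) (≤-reflexive (sym (size X)))
                              (≤-trans (m≤m+n m (10 * m)) (≤-reflexive (sym ∣st∣≡11m))) st-path of λ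
      { (w , c , Q , w∈X , wc , Q-path , st≤m+Q , Q≤st) →
      case rooted X w∈X of λ
      { (P , P-path) →
        P ++ Q ,
        path-++ (path-mono (⊆H X) P-path) (path-mono (p─q⊆p H (vertices X)) Q-path) wc
          (λ (v∈P , v∈Q) → outside∩X≡∅ σ (path-⊆ Q-path v∈Q) (path-⊆ P-path v∈P)) ,
        subst (λ ℓ → 10 * m ≤ ℓ × ℓ ≤ 12 * m) (sym (length-++ P))
          (length-bounds (≤-trans (path-length≤ P-path) (≤-reflexive (size X))) st≤m+Q Q≤st ∣st∣≡11m) } } }

-- Only condition (i) of the expander property is used, and 14m ≤ |H| already suffices.
lemma3p5 : ∀ {N} (G : Graph N) (H : Subset N) (m n : ℕ) → NonZero m → NonZero n →
    ¬ ComplementHasKmm G m → IsExpander G H 3 m n → 61 * m ≤ ∣ H ∣ →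
    ∀ x y → x ∈ H → y ∈ H → ¬ x ≡ y →
    Σ (List (Fin N)) λ P → IsPathIn G H x y P × 10 * m ≤ length P × length P ≤ 12 * m
lemma3p5 G H m _ m-nonZero _ Kmm-free (expands , _) 61m≤∣H∣ x y x∈H y∈H x≢y =
  path-between G H 1≤m Kmm-free (≤-trans (*-monoˡ-≤ m (m≤m+n 14 47)) 61m≤∣H∣)
    (seeds-of-size G H m expands x∈H y∈H x≢y m 1≤m ≤-refl)
  where
  1≤m : 1 ≤ m
  1≤m = >-nonZero⁻¹ m {{m-nonZero}}
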